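{- Let $\Sigma^{\mathcal I}$ be an indefinitely large signature, $\mathcal M_{\mathcal I}$ a $\Sigma^{\mathcal I}$-structure, and $\mathcal T$ a finite set of formulas. Then there is an indefinitely large $\ll$-relation that is adequate for $\mathcal T$.
   Context: $\mathcal I$: non-empty set with directed preorder $\le$; $\uparrow i=\{i'\ge i\}$. Contexts $C=(i_0,\dots,i_{n-1})\in\mathcal I^n$, $()$ empty, $Ci$ extension. $\mathfrak D_n$: $\mathcal H\in\mathfrak D_0$ iff $\mathcal H=\{()\}$; $\mathcal H\in\mathfrak D_1$ iff $\uparrow i\subseteq\mathcal H$ for some $i$; for $\mathcal H\subseteq\mathcal I^{n+1}$, $\mathcal H\in\mathfrak D_{n+1}$ iff $\{C\in\mathcal I^n:\{i:Ci\in\mathcal H\}\in\mathfrak D_1\}\in\mathfrak D_n$. System $\mathcal M_{\mathcal I}=(\mathcal M_i)$: finite sets, increasing along $\le$, at least one non-empty; $\mathcal M_C=\mathcal M_{i_0}\times\dots\times\mathcal M_{i_{n-1}}$. $k$-ary relation: compatible family $(R_C)_{C\in\mathcal H}$, $\emptyset\ne\mathcal H\subseteq\mathcal I^k$, $R_C\subseteq\mathcal M_C$. $\Sigma$: first-order signature with relation symbols only; $\Sigma^{\mathcal I}$: assignments $R:C$, $C\in\mathcal I^{\mathrm{arity}(R)}$, at least one per symbol; indefinitely large iff $\{C:R:C\in\Sigma^{\mathcal I}\}\in\mathfrak D_n$ for each $n$-ary $R$. $\Sigma^{\mathcal I}$-structure: system plus, per symbol $R$, a relation $R_{\mathcal H}$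 with $\mathcal H\supseteq\{C:R:C\in\Sigma^{\mathcal I}\}$. A $\ll$-relation: $(\ll_n)_n$, $\ll_n\subseteq\mathcal I^n$, $Ci\in\ll_{n+1}\Rightarrow C\in\ll_n$; indefinitely large iff $\ll_n\in\mathfrak D_n$ for all $n$. Formulas: first-order over $\Sigma$, variables $x_0,x_1,\dots$, $\bot,\to,\land,\lor,\forall,\exists$, no function symbols; $n$-ary formulas have free variables among $x_0,\dots,x_{n-1}$ and quantifiers bind $x_n$. Auxiliary interpretation $\models_m$: state declarations $C\vdash_m\Phi$ for all contexts: $C\vdash_m\bot$; $C\vdash_m Rx_{k_0}\dots x_{k_{m-1}}$ iff some $j_l\ge i_{k_l}$ with $R:(j_0,\dots,j_{m-1})\in\Sigma^{\mathcal I}$; connectives: both parts declared; $C\vdash_m\forall x\Psi$ iff $C\vdash_m\exists x\Psi$ iff $Ci\vdash_m\Psi$ for some $i$. For $C\vdash_m\Phi$, $\vec a\in\mathcal M_C$: atomic $\models_m Rx_{k_0}\dots[\vec a:C]$ iff $R_{(j_0,\dots)}(a_{k_0},\dots)$ for some declared $(j_0,\dots)$; $\bot$ false; connectives classical; $\forall x\Phi$: $\Phi[\vec ab:Ci]$ for all $i$ and all $b\in\mathcal M_i$; $\exists x\Phi$: for some $i$ and some $b\in\mathcal M_i$. $[\![\Psi]\!]^m$ is the family $([\![\Psi]\!]^m_C)_{C\vdash_m\Psi}$, $[\![\Psi]\!]^m_C=\{\vec a\in\mathcal M_C:\models_m\Psi[\vec a:C]\}$. For an $(n+1)$-ary relation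 $R_{\mathcal H}$, $C\in\mathcal I^n$, $\vec a\in\mathcal M_C$: $\mathcal I_{R,\vec a:C}=\{i:Ci\in\mathcal H,\exists b\in\mathcal M_i\,R_{Ci}(\vec ab)\}$ if non-empty, else $\mathcal I$; $(\ll_R)_{n+1}=\{Ci: i\in\bigcap_{\vec a\in\mathcal M_C}\mathcal I_{R,\vec a:C}\}$; $\ll_R$ is generated by it (lower levels: prefixes; higher levels: $(\ll_R)_{n+1}\times\mathcal I^{m-n-1}$). For a set $\mathcal S$ of relations, $(\ll_{\mathcal S})_m=\bigcap_{R\in\mathcal S}(\ll_R)_m$. For a set of formulas $\mathcal T$, $\hat{\mathcal T}$ is obtained by replacing every $\forall x$ by $\neg\exists x\neg$ and closing under subformulas; $\mathcal S_{\mathcal T}=\{[\![\Psi]\!]^m:\exists x\Psi\in\hat{\mathcal T}\}$ and $\ll_{\mathcal T}=\ll_{\mathcal S_{\mathcal T}}$. A $\ll$-relation $\ll$ is adequate for $\mathcal T$ iff $\ll_n\subseteq(\ll_{\mathcal T})_n$ for all $n$. -}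

module Defs where

open import Data.Nat using (ℕ; zero; suc)
open import Data.Fin using (Fin; toℕ)
open import Data.Vec using (Vec; []; _∷_; _∷ʳ_; lookup; map)
open import Data.List using (List)
open import Data.List.Membership.Propositional using (_∈_)
open import Data.Product using (Σ; ∃; ∃-syntax; _×_; _,_)
open import Data.Sum using (_⊎_)
open import Data.Empty using (⊥)
open import Data.Unit using (⊤)
open import Relation.Nullary using (¬_)
open import Relation.Binary.PropositionalEquality using (_≡_)

record DirectedPreorder : Set₁ where
  field
    Idx       : Set
    _≤_       : Idx → Idx → Set
    ≤-refl    : ∀ i → i ≤ i
    ≤-trans   : ∀ {i j k} → i ≤ j → j ≤ k → i ≤ k
    directed  : ∀ i j → ∃[ k ] (i ≤ k × j ≤ k)
    inhabited : Idx

record Signature : Set₁ where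
  field
    Sym   : Set
    arity : Sym → ℕ

-- Formulas: Form n = n-ary formulas (free variables among x_0..x_{n-1});
-- quantifiers in Form n bind x_n (the body lives in Form (suc n)).

module _ (Sg : Signature) where
  open Signature Sg

  data Form : ℕ → Set where
    atom : ∀ {n} (s : Sym) → Vec (Fin n) (arity s) → Form n
    fal  : ∀ {n} → Form n
    imp  : ∀ {n} → Form n → Form n → Form n
    and  : ∀ {n} → Form n → Form n → Form n
    or   : ∀ {n} → Form n → Form n → Form n
    all  : ∀ {n} → Form (suc n) → Form n
    ex   : ∀ {n} → Form (suc n) → Form n

  hatTr : ∀ {n} → Form n → Form n
  hatTr (atom s ks) = atom s ks
  hatTr fal         = fal
  hatTr (imp φ ψ)   = imp (hatTr φ) (hatTr ψ)
  hatTr (and φ ψ)   = and (hatTr φ) (hatTr ψ)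
  hatTr (or φ ψ)    = or (hatTr φ) (hatTr ψ)
  hatTr (all φ)     = imp (ex (imp (hatTr φ) fal)) fal
  hatTr (ex φ)      = ex (hatTr φ)

  data Sub {m : ℕ} (ψ : Form m) : ∀ {n} → Form n → Set where
    sub-refl : Sub ψ ψ
    sub-impl : ∀ {n} {φ₁ φ₂ : Form n} → Sub ψ φ₁ → Sub ψ (imp φ₁ φ₂)
    sub-impr : ∀ {n} {φ₁ φ₂ : Form n} → Sub ψ φ₂ → Sub ψ (imp φ₁ φ₂)
    sub-andl : ∀ {n} {φ₁ φ₂ : Form n} → Sub ψ φ₁ → Sub ψ (and φ₁ φ₂)
    sub-andr : ∀ {n} {φ₁ φ₂ : Form n} → Sub ψ φ₂ → Sub ψ (and φ₁ φ₂)
    sub-orl  : ∀ {n} {φ₁ φ₂ : Form n} → Sub ψ φ₁ → Sub ψ (or φ₁ φ₂)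
    sub-orr  : ∀ {n} {φ₁ φ₂ : Form n} → Sub ψ φ₂ → Sub ψ (or φ₁ φ₂)
    sub-all  : ∀ {n} {φ : Form (suc n)} → Sub ψ φ → Sub ψ (all φ)
    sub-ex   : ∀ {n} {φ : Form (suc n)} → Sub ψ φ → Sub ψ (ex φ)

  FormulaSet : Set
  FormulaSet = List (Σ ℕ Form)

  InHat : FormulaSet → ∀ {m} → Form m → Set
  InHat T ψ = ∃[ nφ ] (nφ ∈ T × Sub ψ (hatTr (Σ.proj₂ nφ)))

module _ (P : DirectedPreorder) where
  open DirectedPreorder P

  Ctx : ℕ → Set
  Ctx = Vec Idx

  Up : (Idx → Set) → Set
  Up H = ∃[ i ] (∀ j → i ≤ j → H j)

  𝔇 : (n : ℕ) → (Ctx n → Set) → Set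
  𝔇 zero    H = H []
  𝔇 (suc n) H = 𝔇 n (λ C → Up (λ i → H (C ∷ʳ i)))

  record LLRel : Set₁ where
    field
      ll     : (n : ℕ) → Ctx n → Set
      closed : ∀ n (C : Ctx n) i → ll (suc n) (C ∷ʳ i) → ll n C

  IndefLargeLL : LLRel → Set
  IndefLargeLL L = ∀ n → 𝔇 n (LLRel.ll L n)

  record System : Set₁ where
    field
      Elt      : Set
      M        : Idx → List Elt
      mono     : ∀ {i j} → i ≤ j → ∀ {x} → x ∈ M i → x ∈ M j
      nonempty : ∃[ i ] ∃[ x ] (x ∈ M i)

  module _ (S : System) where
    open System S

    MC : ∀ {n} → Ctx n → Vec Elt n → Set
    MC C a = ∀ k → lookup a k ∈ M (lookup C k)

    record Relation (k : ℕ) : Set₁ where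
      field
        dom    : Ctx k → Set
        dom-ne : ∃ dom
        R      : Ctx k → Vec Elt k → Set
        R⊆M    : ∀ {C a} → dom C → R C a → MC C a
        compat : ∀ {C C' a} → dom C → dom C' → MC C a → MC C' a →
                 R C a → R C' a

    IR : ∀ {n} → (Ctx (suc n) → Set) → (Ctx (suc n) → Vec Elt (suc n) → Set) →
         Ctx n → Vec Elt n → Idx → Set
    IR dom R C a i = Sset i ⊎ ¬ (∃ Sset)
      where
      Sset : Idx → Set
      Sset j = dom (C ∷ʳ j) × ∃[ b ] (b ∈ M j × R (C ∷ʳ j) (a ∷ʳ b))

    topR : ∀ {n} → (Ctx (suc n) → Set) → (Ctx (suc n) → Vec Elt (suc n) → Set) →
           Ctx (suc n) → Set
    topR {n} dom R E =
      ∃[ C ] ∃[ i ] (E ≡ C ∷ʳ i × (∀ a → MC {n} C a → IR dom R C a i))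

    Agree : ∀ {m k} → Ctx m → Ctx k → Set
    Agree C' E = ∀ p q → toℕ p ≡ toℕ q → lookup C' p ≡ lookup E q

    -- ≪_R generated by (≪_R)_{n+1}:
    --  level m ≤ n+1 : prefixes;  level m > n+1 : (≪_R)_{n+1} × ℐ^{m-n-1}
    llR : ∀ {n} → (Ctx (suc n) → Set) → (Ctx (suc n) → Vec Elt (suc n) → Set) →
          (m : ℕ) → Ctx m → Set
    llR {n} dom R m C' = ∃[ E ] (topR {n} dom R E × Agree C' E)

  record SigI (Sg : Signature) : Set₁ where
    open Signature Sg
    field
      Assign     : (s : Sym) → Ctx (arity s) → Set
      atLeastOne : ∀ s → ∃ (Assign s)

  IndefLargeSig : ∀ {Sg} → SigI Sg → Set
  IndefLargeSig {Sg} SI = ∀ s → 𝔇 (Signature.arity Sg s) (SigI.Assign SI s)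

  record Structure {Sg : Signature} (SI : SigI Sg) : Set₁ where
    open Signature Sg
    field
      sys     : System
      rel     : (s : Sym) → Relation sys (arity s)
      covers  : ∀ s C → SigI.Assign SI s C → Relation.dom (rel s) C

  module _ {Sg : Signature} {SI : SigI Sg} (St : Structure SI) where
    open Signature Sg
    open SigI SI
    open Structure St
    open System sys

    Decl : ∀ {n} → Ctx n → Form Sg n → Set
    Decl C (atom s ks) =
      ∃[ js ] ((∀ l → lookup C (lookup ks l) ≤ lookup js l) × Assign s js)
    Decl C fal       = ⊤
    Decl C (imp φ ψ) = Decl C φ × Decl C ψ
    Decl C (and φ ψ) = Decl C φ × Decl C ψ
    Decl C (or φ ψ)  = Decl C φ × Decl C ψ
    Decl C (all φ)   = ∃[ i ] Decl (C ∷ʳ i) φ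
    Decl C (ex φ)    = ∃[ i ] Decl (C ∷ʳ i) φ

    Sat : ∀ {n} → Ctx n → Vec Elt n → Form Sg n → Set
    Sat C a (atom s ks) =
      ∃[ js ] ((∀ l → lookup C (lookup ks l) ≤ lookup js l) × Assign s js ×
               Relation.R (rel s) js (map (lookup a) ks))
    Sat C a fal       = ⊥
    Sat C a (imp φ ψ) = Sat C a φ → Sat C a ψ
    Sat C a (and φ ψ) = Sat C a φ × Sat C a ψ
    Sat C a (or φ ψ)  = Sat C a φ ⊎ Sat C a ψ
    Sat C a (all φ)   = ∀ i b → b ∈ M i → Sat (C ∷ʳ i) (a ∷ʳ b) φ
    Sat C a (ex φ)    = ∃[ i ] ∃[ b ] (b ∈ M i × Sat (C ∷ʳ i) (a ∷ʳ b) φ)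

    semDom : ∀ {n} → Form Sg n → Ctx n → Set
    semDom Ψ C = Decl C Ψ

    semRel : ∀ {n} → Form Sg n → Ctx n → Vec Elt n → Set
    semRel Ψ C a = MC sys C a × Sat C a Ψ

    llT : FormulaSet Sg → (m : ℕ) → Ctx m → Set
    llT T m C = ∀ n (Ψ : Form Sg (suc n)) → InHat Sg T (ex Ψ) →
                llR sys {n} (semDom Ψ) (semRel Ψ) m C

    Adequate : FormulaSet Sg → LLRel → Set
    Adequate T L = ∀ m (C : Ctx m) → LLRel.ll L m C → llT T m C

-- Take ≪ := ≪_𝒯 itself; it is prefix-closed, so only indefinite largeness
-- needs an argument. Since 𝔇_m is a filter and 𝒯̂ has finitely many
-- formulas ∃xΨ, it suffices that each ≪_[[Ψ]] is indefinitely large, and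
-- by its construction that for every context C the set ⋂_a ℐ_{[[Ψ]],a:C}
-- contains an up-set. As M_C is finite, this reduces to a single ℐ_{a:C}.
-- By excluded middle either no witness b exists, and ℐ_{a:C} = ℐ, or one
-- exists at some index j; then it is a witness at every i ≥ j, because
-- the M_i increase, every context declares every formula (the signature is
-- indefinitely large), and satisfaction does not depend on the context in
-- which a tuple is read (relations are compatible families).
module Submission where

open import Defs
open import Level using (0ℓ)
open import Axiom.ExcludedMiddle using (ExcludedMiddle)
open import Data.Product using (∃-syntax; _×_)

open import Data.Nat as ℕ using (ℕ; zero; suc; _≤′_; z≤n; s≤s; ≤′-refl; ≤′-step)
open import Data.Nat.Properties using (≤-<-connex; ≤⇒≤′; suc-injective)
open import Data.Fin using (Fin; zero; suc; toℕ; inject₁; fromℕ)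
open import Data.Fin.Properties using (toℕ-inject₁)
open import Data.Vec using (Vec; []; _∷_; _∷ʳ_; lookup; map; replicate)
open import Data.Vec.Properties using (lookup-map)
open import Data.List using (List; []; _∷_)
open import Data.List.Membership.Propositional using (_∈_)
open import Data.List.Relation.Unary.Any using (here; there)
open import Data.Product using (∃; _,_; proj₂)
open import Data.Sum using (inj₁; inj₂)
open import Data.Unit using (tt)
open import Function using (id; _∘_)
open import Relation.Nullary using (yes; no)
open import Relation.Binary.PropositionalEquality using (_≡_; refl; sym; trans; subst)

lookup-∷ʳ-inject₁ : ∀ {A : Set} {n} (v : Vec A n) x (l : Fin n) →
                    lookup (v ∷ʳ x) (inject₁ l) ≡ lookup v l
lookup-∷ʳ-inject₁ (y ∷ v) x zero    = refl
lookup-∷ʳ-inject₁ (y ∷ v) x (suc l) = lookup-∷ʳ-inject₁ v x l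

∀-lookup-∷ʳ : ∀ {A : Set} {n} (v : Vec A n) x (Q : Fin (suc n) → A → Set) →
              (∀ l → Q (inject₁ l) (lookup v l)) → Q (fromℕ n) x →
              ∀ l → Q l (lookup (v ∷ʳ x) l)
∀-lookup-∷ʳ []      x Q qv qx zero    = qx
∀-lookup-∷ʳ (y ∷ v) x Q qv qx zero    = qv zero
∀-lookup-∷ʳ (y ∷ v) x Q qv qx (suc l) = ∀-lookup-∷ʳ v x (Q ∘ suc) (qv ∘ suc) qx l

record IsFilter {B : Set} (Large : (B → Set) → Set) : Set₁ where
  field
    mono      : ∀ {H H' : B → Set} → (∀ b → H b → H' b) → Large H → Large H'
    universal : ∀ {H : B → Set} → (∀ b → H b) → Large H
    ∩-closed  : ∀ {H H' : B → Set} → Large H → Large H' → Large (λ b → H b × H' b)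

  ⋂-closed : ∀ {A : Set} (xs : List A) {H : A → B → Set} →
             (∀ x → x ∈ xs → Large (H x)) → Large (λ b → ∀ x → x ∈ xs → H x b)
  ⋂-closed []       large = universal (λ _ _ ())
  ⋂-closed (y ∷ ys) large =
    mono (λ { b (hy , hys) x (here refl) → hy ; b (hy , hys) x (there x∈ys) → hys x x∈ys })
         (∩-closed (large y (here refl)) (⋂-closed ys (λ x → large x ∘ there)))

module _ (P : DirectedPreorder) where
  open DirectedPreorder P

  Up-isFilter : IsFilter (Up P)
  Up-isFilter = record
    { mono      = λ { f (i , h) → i , λ j i≤j → f j (h j i≤j) }
    ; universal = λ f → inhabited , λ j _ → f j
    ; ∩-closed  = λ { (i , h) (i' , h') → ∩-witness (directed i i') h h' }
    }
    where
    ∩-witness : ∀ {i i'} {H H' : Idx → Set} → ∃[ k ] (i ≤ k × i' ≤ k) →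
                (∀ j → i ≤ j → H j) → (∀ j → i' ≤ j → H' j) → Up P (λ j → H j × H' j)
    ∩-witness (k , i≤k , i'≤k) h h' = k , λ j k≤j → h j (≤-trans i≤k k≤j) , h' j (≤-trans i'≤k k≤j)

  module UpFilter = IsFilter Up-isFilter

  𝔇-isFilter : ∀ n → IsFilter (𝔇 P n)
  𝔇-isFilter zero    = record { mono = λ f → f [] ; universal = λ f → f [] ; ∩-closed = _,_ }
  𝔇-isFilter (suc n) = record
    { mono      = λ f → mono (λ C → UpFilter.mono (λ i → f (C ∷ʳ i)))
    ; universal = λ f → universal (λ C → UpFilter.universal (λ i → f (C ∷ʳ i)))
    ; ∩-closed  = λ d d' → mono (λ { C (u , u') → UpFilter.∩-closed u u' }) (∩-closed d d')
    }
    where open IsFilter (𝔇-isFilter n)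

  𝔇-cofinal : ∀ k {H : Ctx P k → Set} → 𝔇 P k H → (bound : Fin k → Idx) →
              ∃[ C ] ((∀ l → bound l ≤ lookup C l) × H C)
  𝔇-cofinal zero    d bound = [] , (λ ()) , d
  𝔇-cofinal (suc k) d bound with 𝔇-cofinal k d (bound ∘ inject₁)
  ... | C , bound≤C , (i₀ , up) with directed i₀ (bound (fromℕ k))
  ... | i , i₀≤i , last≤i =
    C ∷ʳ i , ∀-lookup-∷ʳ C i (λ l j → bound l ≤ j) bound≤C last≤i , up i i₀≤i

  data Prefix : ∀ {m k} → Ctx P m → Ctx P k → Set where
    []  : ∀ {k} {w : Ctx P k} → Prefix [] w
    _∷_ : ∀ {m k} x {v : Ctx P m} {w : Ctx P k} → Prefix v w → Prefix (x ∷ v) (x ∷ w)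

  Prefix-refl : ∀ {m} {v : Ctx P m} → Prefix v v
  Prefix-refl {v = []}    = []
  Prefix-refl {v = x ∷ v} = x ∷ Prefix-refl

  Prefix-trans : ∀ {a b c} {u : Ctx P a} {v : Ctx P b} {w : Ctx P c} →
                 Prefix u v → Prefix v w → Prefix u w
  Prefix-trans []      q        = []
  Prefix-trans (x ∷ p) (.x ∷ q) = x ∷ Prefix-trans p q

  Prefix-∷ʳ : ∀ {m} {v : Ctx P m} x → Prefix v (v ∷ʳ x)
  Prefix-∷ʳ {v = []}    x = []
  Prefix-∷ʳ {v = y ∷ v} x = y ∷ Prefix-∷ʳ x

  Prefix-extension : ∀ {m k} → m ℕ.≤ k → (v : Ctx P m) → ∃ λ (w : Ctx P k) → Prefix v w
  Prefix-extension {k = k} z≤n []      = replicate k inhabited , []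
  Prefix-extension (s≤s m≤k)  (x ∷ v) with Prefix-extension m≤k v
  ... | w , v⊑w = x ∷ w , x ∷ v⊑w

module _ (P : DirectedPreorder) (S : System P) where
  open DirectedPreorder P
  open System S using (Elt; M)

  Agree-sym : ∀ {m k} (v : Ctx P m) (w : Ctx P k) → Agree P S v w → Agree P S w v
  Agree-sym v w agree p q p≡q = sym (agree q p (sym p≡q))

  Prefix⇒Agree : ∀ {m k} {v : Ctx P m} {w : Ctx P k} → Prefix P v w → Agree P S v w
  Prefix⇒Agree (x ∷ v⊑w) zero    zero    _   = refl
  Prefix⇒Agree (x ∷ v⊑w) (suc p) (suc q) p≡q = Prefix⇒Agree v⊑w p q (suc-injective p≡q)

  Agree-∷ʳ⁻ : ∀ {m k} (C : Ctx P m) i (E : Ctx P k) → Agree P S (C ∷ʳ i) E → Agree P S C E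
  Agree-∷ʳ⁻ C i E agree p q p≡q =
    trans (sym (lookup-∷ʳ-inject₁ C i p)) (agree (inject₁ p) q (trans (toℕ-inject₁ p) p≡q))

  MC-∷ʳ : ∀ {n} (C : Ctx P n) (a : Vec Elt n) {i b} →
          MC P S C a → b ∈ M i → MC P S (C ∷ʳ i) (a ∷ʳ b)
  MC-∷ʳ []      []      a∈M b∈M zero    = b∈M
  MC-∷ʳ (_ ∷ _) (_ ∷ _) a∈M b∈M zero    = a∈M zero
  MC-∷ʳ (_ ∷ C) (_ ∷ a) a∈M b∈M (suc k) = MC-∷ʳ C a (a∈M ∘ suc) b∈M k

  Up-∀-MC : ∀ {n} (C : Ctx P n) {F : Vec Elt n → Idx → Set} →
            (∀ a → MC P S C a → Up P (F a)) → Up P (λ i → ∀ a → MC P S C a → F a i)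
  Up-∀-MC [] large = UpFilter.mono P (λ { j h [] _ → h }) (large [] (λ ()))
  Up-∀-MC (c ∷ C) {F} large =
    UpFilter.mono P (λ { j h (x ∷ a) xa∈M → h a (xa∈M ∘ suc) x (xa∈M zero) })
      (Up-∀-MC C {λ a j → ∀ x → x ∈ M c → F (x ∷ a) j}
        (λ a a∈M → UpFilter.⋂-closed P (M c) (λ x x∈M → large (x ∷ a) (∷-MC x∈M a∈M))))
    where
    ∷-MC : ∀ {x a} → x ∈ M c → MC P S C a → MC P S (c ∷ C) (x ∷ a)
    ∷-MC x∈M a∈M zero    = x∈M
    ∷-MC x∈M a∈M (suc k) = a∈M k

  module _ {n} (dom : Ctx P (suc n) → Set) (R : Ctx P (suc n) → Vec Elt (suc n) → Set) where

    llR-closed : ∀ {m} (C : Ctx P m) i → llR P S dom R (suc m) (C ∷ʳ i) → llR P S dom R m C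
    llR-closed C i (E , top , agree) = E , top , Agree-∷ʳ⁻ C i E agree

    topR-large : (∀ C a → MC P S C a → Up P (IR P S dom R C a)) →
                 ∀ C → Up P (λ i → topR P S dom R (C ∷ʳ i))
    topR-large IR-large C =
      UpFilter.mono P (λ i h → C , i , refl , h) (Up-∀-MC C (IR-large C))

    module _ (top-large : ∀ C → Up P (λ i → topR P S dom R (C ∷ʳ i))) where

      llR-below : ∀ {m} → m ℕ.≤ n → ∀ C → llR P S dom R m C
      llR-below m≤n C with Prefix-extension P m≤n C
      ... | D , C⊑D with top-large D
      ... | j , up = D ∷ʳ j , up j (≤-refl j) , Prefix⇒Agree (Prefix-trans P C⊑D (Prefix-∷ʳ P j))

      topR-prefix-large : ∀ {m} → suc n ≤′ m → 𝔇 P m (λ C → ∃[ E ] (topR P S dom R E × Prefix P E C))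
      topR-prefix-large ≤′-refl =
        universal (λ C → UpFilter.mono P (λ i top → C ∷ʳ i , top , Prefix-refl P) (top-large C))
        where open IsFilter (𝔇-isFilter P n)
      topR-prefix-large (≤′-step {m} n<m) = mono extend (topR-prefix-large n<m)
        where
        open IsFilter (𝔇-isFilter P m)
        extend : ∀ (C : Ctx P m) → ∃[ E ] (topR P S dom R E × Prefix P E C) →
                 Up P (λ i → ∃[ E ] (topR P S dom R E × Prefix P E (C ∷ʳ i)))
        extend C (E , top , E⊑C) = UpFilter.universal P (λ i → E , top , Prefix-trans P E⊑C (Prefix-∷ʳ P i))

      llR-large : ∀ m → 𝔇 P m (llR P S dom R m)
      llR-large m with ≤-<-connex m n
      ... | inj₁ m≤n = IsFilter.universal (𝔇-isFilter P m) (llR-below m≤n)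
      ... | inj₂ n<m = IsFilter.mono (𝔇-isFilter P m)
        (λ { C (E , top , E⊑C) → E , top , Agree-sym E C (Prefix⇒Agree E⊑C) })
        (topR-prefix-large (≤⇒≤′ n<m))

module _ {B : Set} {Large : (B → Set) → Set} (filter : IsFilter Large) (Sg : Signature)
         (H : (n : ℕ) → Form Sg (suc n) → B → Set) (large : ∀ n Ψ → Large (H n Ψ)) where
  open IsFilter filter

  ⋂-∃-Sub-closed : ∀ {k} (φ : Form Sg k) → Large (λ b → ∀ n Ψ → Sub Sg (ex Ψ) φ → H n Ψ b)
  ⋂-∃-Sub-closed (atom s ks) = universal (λ _ _ _ ())
  ⋂-∃-Sub-closed fal         = universal (λ _ _ _ ())
  ⋂-∃-Sub-closed (imp φ ψ)   = mono (λ { b (hφ , hψ) n Ψ (sub-impl s) → hφ n Ψ s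
                                       ; b (hφ , hψ) n Ψ (sub-impr s) → hψ n Ψ s })
                                 (∩-closed (⋂-∃-Sub-closed φ) (⋂-∃-Sub-closed ψ))
  ⋂-∃-Sub-closed (and φ ψ)   = mono (λ { b (hφ , hψ) n Ψ (sub-andl s) → hφ n Ψ s
                                       ; b (hφ , hψ) n Ψ (sub-andr s) → hψ n Ψ s })
                                 (∩-closed (⋂-∃-Sub-closed φ) (⋂-∃-Sub-closed ψ))
  ⋂-∃-Sub-closed (or φ ψ)    = mono (λ { b (hφ , hψ) n Ψ (sub-orl s) → hφ n Ψ s
                                       ; b (hφ , hψ) n Ψ (sub-orr s) → hψ n Ψ s })
                                 (∩-closed (⋂-∃-Sub-closed φ) (⋂-∃-Sub-closed ψ))
  ⋂-∃-Sub-closed (all φ)     = mono (λ { b h n Ψ (sub-all s) → h n Ψ s }) (⋂-∃-Sub-closed φ)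
  ⋂-∃-Sub-closed (ex φ)      = mono (λ { b (hφ , h) n Ψ sub-refl → hφ
                                       ; b (hφ , h) n Ψ (sub-ex s) → h n Ψ s })
                                 (∩-closed (large _ φ) (⋂-∃-Sub-closed φ))

  ⋂-∃-InHat-closed : (T : FormulaSet Sg) → Large (λ b → ∀ n Ψ → InHat Sg T (ex Ψ) → H n Ψ b)
  ⋂-∃-InHat-closed T =
    mono (λ { b h n Ψ (φ , φ∈T , s) → h φ φ∈T n Ψ s })
      (⋂-closed T (λ φ _ → ⋂-∃-Sub-closed (hatTr Sg (proj₂ φ))))

module _ (P : DirectedPreorder) {Sg : Signature} {SI : SigI P Sg}
         (indefLarge : IndefLargeSig P SI) (St : Structure P SI) where
  open DirectedPreorder P
  open Signature Sg
  open SigI SI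
  open Structure St
  open System sys

  Decl-everywhere : ∀ {n} (C : Ctx P n) (φ : Form Sg n) → Decl P St C φ
  Decl-everywhere C (atom s ks) = 𝔇-cofinal P (arity s) (indefLarge s) (lookup C ∘ lookup ks)
  Decl-everywhere C fal         = tt
  Decl-everywhere C (imp φ ψ)   = Decl-everywhere C φ , Decl-everywhere C ψ
  Decl-everywhere C (and φ ψ)   = Decl-everywhere C φ , Decl-everywhere C ψ
  Decl-everywhere C (or φ ψ)    = Decl-everywhere C φ , Decl-everywhere C ψ
  Decl-everywhere C (all φ)     = inhabited , Decl-everywhere (C ∷ʳ inhabited) φ
  Decl-everywhere C (ex φ)      = inhabited , Decl-everywhere (C ∷ʳ inhabited) φ

  Sat-transfer : ∀ {n} (φ : Form Sg n) {C C' : Ctx P n} {a : Vec Elt n} →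
                 MC P sys C a → MC P sys C' a → Sat P St C a φ → Sat P St C' a φ
  Sat-transfer (atom s ks) {C} {C'} {a} a∈MC a∈MC' (js , C≤js , js∈Σ , r)
    with 𝔇-cofinal P (arity s) (indefLarge s) (lookup C' ∘ lookup ks)
  ... | js' , C'≤js' , js'∈Σ =
    js' , C'≤js' , js'∈Σ ,
    Relation.compat (rel s) (covers s js js∈Σ) (covers s js' js'∈Σ)
      (atom-MC C js C≤js a∈MC) (atom-MC C' js' C'≤js' a∈MC') r
    where
    atom-MC : ∀ D zs → (∀ l → lookup D (lookup ks l) ≤ lookup zs l) →
              MC P sys D a → MC P sys zs (map (lookup a) ks)
    atom-MC D zs D≤zs a∈MD l = subst (_∈ M _) (sym (lookup-map l (lookup a) ks))
                                (mono (D≤zs l) (a∈MD (lookup ks l)))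
  Sat-transfer fal       a∈MC a∈MC' ()
  Sat-transfer (imp φ ψ) a∈MC a∈MC' f sφ = Sat-transfer ψ a∈MC a∈MC' (f (Sat-transfer φ a∈MC' a∈MC sφ))
  Sat-transfer (and φ ψ) a∈MC a∈MC' (sφ , sψ) = Sat-transfer φ a∈MC a∈MC' sφ , Sat-transfer ψ a∈MC a∈MC' sψ
  Sat-transfer (or φ ψ)  a∈MC a∈MC' (inj₁ sφ) = inj₁ (Sat-transfer φ a∈MC a∈MC' sφ)
  Sat-transfer (or φ ψ)  a∈MC a∈MC' (inj₂ sψ) = inj₂ (Sat-transfer ψ a∈MC a∈MC' sψ)
  Sat-transfer (all φ) {C} {C'} {a} a∈MC a∈MC' f i b b∈M =
    Sat-transfer φ (MC-∷ʳ P sys C a a∈MC b∈M) (MC-∷ʳ P sys C' a a∈MC' b∈M) (f i b b∈M)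
  Sat-transfer (ex φ) {C} {C'} {a} a∈MC a∈MC' (i , b , b∈M , sφ) =
    i , b , b∈M , Sat-transfer φ (MC-∷ʳ P sys C a a∈MC b∈M) (MC-∷ʳ P sys C' a a∈MC' b∈M) sφ

  IR-large : ExcludedMiddle 0ℓ → ∀ {n} (Ψ : Form Sg (suc n)) C a → MC P sys C a →
             Up P (IR P sys (semDom P St Ψ) (semRel P St Ψ) C a)
  IR-large em Ψ C a a∈MC
    with em {∃[ j ] (semDom P St Ψ (C ∷ʳ j) × ∃[ b ] (b ∈ M j × semRel P St Ψ (C ∷ʳ j) (a ∷ʳ b)))}
  ... | no none = UpFilter.universal P (λ _ → inj₂ none)
  ... | yes (j , _ , b , b∈Mj , ab∈MC , sat) = j , witness
    where
    witness : ∀ i → j ≤ i → IR P sys (semDom P St Ψ) (semRel P St Ψ) C a i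
    witness i j≤i = inj₁ (Decl-everywhere (C ∷ʳ i) Ψ , b , b∈Mi , ab∈MCi , Sat-transfer Ψ ab∈MC ab∈MCi sat)
      where
      b∈Mi = mono j≤i b∈Mj
      ab∈MCi = MC-∷ʳ P sys C a a∈MC b∈Mi

lemma4p11 : ExcludedMiddle 0ℓ →
    (P : DirectedPreorder) (Sg : Signature) (SI : SigI P Sg) →
    IndefLargeSig P SI →
    (St : Structure P SI) (T : FormulaSet Sg) →
    ∃[ L ] (IndefLargeLL P L × Adequate P St T L)
lemma4p11 em P Sg SI indefLarge St T = ≪T , ≪T-large , λ m C → id
  where
  open Structure St using (sys)

  ≪T : LLRel P
  ≪T = record
    { ll     = llT P St T
    ; closed = λ m C i h n Ψ ∃Ψ∈T̂ → llR-closed P sys (semDom P St Ψ) (semRel P St Ψ) C i (h n Ψ ∃Ψ∈T̂)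
    }

  ⟦_⟧-large : ∀ {n} (Ψ : Form Sg (suc n)) m → 𝔇 P m (llR P sys (semDom P St Ψ) (semRel P St Ψ) m)
  ⟦ Ψ ⟧-large = llR-large P sys (semDom P St Ψ) (semRel P St Ψ)
    (topR-large P sys (semDom P St Ψ) (semRel P St Ψ) (IR-large P indefLarge St em Ψ))

  ≪T-large : IndefLargeLL P ≪T
  ≪T-large m = ⋂-∃-InHat-closed (𝔇-isFilter P m) Sg _ (λ n Ψ → ⟦ Ψ ⟧-large m) T
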